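{- Every matching covered hamiltonian graph is 3PM-admissible.
   Context: A graph is matching covered if it is connected and every edge lies in some perfect matching. A matching covered graph $G$ is 3PM-admissible if there exist three perfect matchings $M_1,M_2,M_3$ of $G$ with $M_1\cap M_2\cap M_3=\emptyset$. A graph is hamiltonian if it has a cycle through all its vertices. -}

module Defs where

open import Data.Nat using (ℕ; _≤_)
open import Data.Fin using (Fin)
open import Data.List using (List; []; _∷_; _++_; [_]; length)
open import Data.List.Membership.Propositional using (_∈_)
open import Data.List.Relation.Unary.Unique.Propositional using (Unique)
open import Data.List.Relation.Unary.Linked using (Linked)
open import Data.Product using (Σ; _×_; ∃; ∃-syntax)
open import Data.Empty using (⊥)
open import Relation.Nullary using (¬_)
open import Relation.Binary.PropositionalEquality using (_≡_)
open import Level using (0ℓ)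

record Graph : Set₁ where
  field
    n      : ℕ
    Adj    : Fin n → Fin n → Set
    sym    : ∀ {u v} → Adj u v → Adj v u
    irrefl : ∀ {u} → ¬ Adj u u

module _ (G : Graph) where
  open Graph G

  data Walk : Fin n → Fin n → Set where
    here : ∀ {u} → Walk u u
    step : ∀ {u v w} → Adj u v → Walk v w → Walk u w

  Connected : Set
  Connected = ∀ u v → Walk u v

  record EdgeSet : Set₁ where
    field
      Has    : Fin n → Fin n → Set
      has-sym : ∀ {u v} → Has u v → Has v u
      has-adj : ∀ {u v} → Has u v → Adj u v

  record PerfectMatching : Set₁ where
    field
      edges  : EdgeSet
    open EdgeSet edges public
    field
      cover  : ∀ u → ∃[ v ] Has u v
      unique : ∀ {u v w} → Has u v → Has u w → v ≡ w

  open PerfectMatching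

  MatchingCovered : Set₁
  MatchingCovered =
    Connected × (∀ u v → Adj u v → Σ PerfectMatching (λ M → Has M u v))

  ThreePMAdmissible : Set₁
  ThreePMAdmissible =
    MatchingCovered ×
    Σ PerfectMatching λ M₁ → Σ PerfectMatching λ M₂ → Σ PerfectMatching λ M₃ →
      ∀ u v → Has M₁ u v → Has M₂ u v → Has M₃ u v → ⊥

  Hamiltonian : Set
  Hamiltonian =
    Σ (Fin n) λ v → Σ (List (Fin n)) λ vs →
      Unique (v ∷ vs) ×
      (∀ u → u ∈ (v ∷ vs)) ×
      3 ≤ length (v ∷ vs) ×
      Linked Adj (v ∷ vs ++ [ v ])

-- A matching covered graph with an edge has a perfect matching, i.e. a fixed-point-free
-- involution of its vertices, so it has an even number of vertices. A hamiltonian cycle of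
-- even length then splits into its "even" and "odd" edges, two disjoint perfect matchings
-- M₀ and M₁, and M₀, M₁, M₀ have empty intersection.
module Submission where

open import Defs
open import Data.Nat using (_≤_; _<_; s≤s)
open import Data.Nat.Properties using (n<1+n; m<n⇒m<1+n)
open import Data.Nat.Induction using (<-wellFounded)
open import Data.Nat.Divisibility using (_∣_; _∣0; ∣-refl; ∣1⇒≡1; ∣m∣n⇒∣m+n; ∣m+n∣m⇒∣n)
open import Data.Fin using (Fin)
open import Data.List using (List; []; _∷_; _++_; [_]; _∷ʳ_; length)
open import Data.List.Membership.Propositional using (_∈_; _∉_)
open import Data.List.Membership.Propositional.Properties using (∈-∃++; ∈-++⁻)
open import Data.List.Relation.Unary.Any using (here; there)
open import Data.List.Relation.Unary.Unique.Propositional using (Unique; _∷_)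
open import Data.List.Relation.Unary.Unique.Propositional.Properties using (Unique[x∷xs]⇒x∉xs)
open import Data.List.Relation.Unary.Linked as Linked using (Linked; []; [-]; _∷_)
open import Data.List.Relation.Binary.Permutation.Propositional using (_↭_; prep; ↭-sym; ↭⇒↭ₛ)
open import Data.List.Relation.Binary.Permutation.Propositional.Properties using (shift; ∷↭∷ʳ; ∈-resp-↭; ↭-length)
import Data.List.Relation.Binary.Permutation.Setoid.Properties as Permutationₛ
open import Data.Product using (_×_; _,_; proj₁; proj₂; ∃-syntax)
open import Data.Sum using (inj₁; inj₂)
open import Data.Empty using (⊥; ⊥-elim)
open import Function using (_∘_)
open import Induction.WellFounded using (Acc; acc)
open import Relation.Binary.Definitions using (Symmetric)
open import Relation.Binary.PropositionalEquality using (_≡_; _≢_; refl; sym; trans; cong; subst; setoid)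

private variable
  A : Set
  b e u v w x y : A
  xs ys zs : List A

Unique-resp-↭ : {A : Set} {xs ys : List A} → xs ↭ ys → Unique xs → Unique ys
Unique-resp-↭ {A} σ = Permutationₛ.Unique-resp-↭ (setoid A) (↭⇒↭ₛ σ)

∉-∷ʳ : x ∉ xs → x ≢ y → x ∉ xs ∷ʳ y
∉-∷ʳ {xs = xs} x∉xs x≢y x∈ with ∈-++⁻ xs x∈
... | inj₁ x∈xs       = x∉xs x∈xs
... | inj₂ (here x≡y) = x≢y x≡y

Linked-++⁻ˡ : ∀ {R : A → A → Set} xs → Linked R (xs ++ ys) → Linked R xs
Linked-++⁻ˡ []           _        = []
Linked-++⁻ˡ (_ ∷ [])     _        = [-]
Linked-++⁻ˡ (_ ∷ _ ∷ xs) (r ∷ rs) = r ∷ Linked-++⁻ˡ (_ ∷ xs) rs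

module Involution {p : A → A} (p-involutive : ∀ x → p (p x) ≡ x) (p-no-fixed-point : ∀ x → p x ≢ x) where

  p-injective : p x ≡ p y → x ≡ y
  p-injective {x} {y} eq = trans (sym (p-involutive x)) (trans (cong p eq) (p-involutive y))

  Closed : List A → Set
  Closed xs = ∀ {x} → x ∈ xs → p x ∈ xs

  peel-orbit : Unique (x ∷ xs) → Closed (x ∷ xs) →
         ∃[ zs ] (x ∷ xs ↭ x ∷ p x ∷ zs) × Unique zs × Closed zs
  peel-orbit {x} uniq closed with closed (here refl)
  ... | here px≡x = ⊥-elim (p-no-fixed-point x px≡x)
  ... | there px∈xs with ∈-∃++ px∈xs
  ... | as , bs , refl = as ++ bs , σ , uniq-zs , closed-zs
    where
    σ : x ∷ as ++ [ p x ] ++ bs ↭ x ∷ p x ∷ as ++ bs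
    σ = prep x (shift (p x) as bs)

    uniq′ : Unique (x ∷ p x ∷ as ++ bs)
    uniq′ = Unique-resp-↭ σ uniq

    uniq-zs : Unique (as ++ bs)
    uniq-zs with _ ∷ _ ∷ u ← uniq′ = u

    x∉zs : x ∉ as ++ bs
    x∉zs = Unique[x∷xs]⇒x∉xs uniq′ ∘ there

    px∉zs : p x ∉ as ++ bs
    px∉zs with _ ∷ uniq″ ← uniq′ = Unique[x∷xs]⇒x∉xs uniq″

    closed-zs : Closed (as ++ bs)
    closed-zs {y} y∈zs with ∈-resp-↭ σ (closed (∈-resp-↭ (↭-sym σ) (there (there y∈zs))))
    ... | here py≡x =
      ⊥-elim (px∉zs (subst (_∈ as ++ bs) (trans (sym (p-involutive y)) (cong p py≡x)) y∈zs))
    ... | there (here py≡px)  = ⊥-elim (x∉zs (subst (_∈ as ++ bs) (p-injective py≡px) y∈zs))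
    ... | there (there py∈zs) = py∈zs

  even-length : Unique xs → Closed xs → 2 ∣ length xs
  even-length = go (<-wellFounded _)
    where
    go : ∀ {xs} → Acc _<_ (length xs) → Unique xs → Closed xs → 2 ∣ length xs
    go {[]}     _        _    _      = 2 ∣0
    go {x ∷ xs} (acc rs) uniq closed with peel-orbit uniq closed
    ... | zs , σ , uniq-zs , closed-zs =
      subst (2 ∣_) (sym (↭-length σ)) (∣m∣n⇒∣m+n ∣-refl (go (rs shorter) uniq-zs closed-zs))
      where
      shorter : length zs < length (x ∷ xs)
      shorter = subst (length zs <_) (sym (↭-length σ)) (m<n⇒m<1+n (n<1+n _))

data Paired {A : Set} : List A → A → A → Set where
  first  : Paired (x ∷ y ∷ zs) x y
  second : Paired (x ∷ y ∷ zs) y x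
  later  : Paired zs u w → Paired (x ∷ y ∷ zs) u w

Paired-sym : Paired xs u w → Paired xs w u
Paired-sym first     = second
Paired-sym second    = first
Paired-sym (later p) = later (Paired-sym p)

Paired-∈ : Paired xs u w → u ∈ xs
Paired-∈ first     = here refl
Paired-∈ second    = there (here refl)
Paired-∈ (later p) = there (there (Paired-∈ p))

Paired⇒related : ∀ {R : A → A → Set} → Symmetric R → Linked R xs → Paired xs u w → R u w
Paired⇒related _     (r ∷ _)  first     = r
Paired⇒related R-sym (r ∷ _)  second    = R-sym r
Paired⇒related R-sym (_ ∷ rs) (later p) = Paired⇒related R-sym (Linked.tail rs) p

Paired-cover : 2 ∣ length xs → u ∈ xs → ∃[ w ] Paired xs u w
Paired-cover {xs = _ ∷ []}     2∣1 _ with () ← ∣1⇒≡1 2∣1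
Paired-cover {xs = _ ∷ _ ∷ _} _ (here refl)         = _ , first
Paired-cover {xs = _ ∷ _ ∷ _} _ (there (here refl)) = _ , second
Paired-cover {xs = _ ∷ _ ∷ _} 2∣2+n (there (there u∈zs))
  with w , p ← Paired-cover (∣m+n∣m⇒∣n 2∣2+n ∣-refl) u∈zs = w , later p

Paired-functional : Unique xs → Paired xs u v → Paired xs u w → v ≡ w
Paired-functional _              first     first     = refl
Paired-functional _              second    second    = refl
Paired-functional uniq           first     second    = ⊥-elim (Unique[x∷xs]⇒x∉xs uniq (here refl))
Paired-functional uniq           second    first     = ⊥-elim (Unique[x∷xs]⇒x∉xs uniq (here refl))
Paired-functional uniq           first     (later q) = ⊥-elim (Unique[x∷xs]⇒x∉xs uniq (there (Paired-∈ q)))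
Paired-functional uniq           (later p) first     = ⊥-elim (Unique[x∷xs]⇒x∉xs uniq (there (Paired-∈ p)))
Paired-functional (_ ∷ uniq)     second    (later q) = ⊥-elim (Unique[x∷xs]⇒x∉xs uniq (Paired-∈ q))
Paired-functional (_ ∷ uniq)     (later p) second    = ⊥-elim (Unique[x∷xs]⇒x∉xs uniq (Paired-∈ p))
Paired-functional (_ ∷ _ ∷ uniq) (later p) (later q) = Paired-functional uniq p q

Paired-offset-disjoint : Unique (b ∷ xs) → e ∉ xs → Paired xs u w → Paired (b ∷ xs ++ [ e ]) u w → ⊥
Paired-offset-disjoint {xs = _ ∷ _ ∷ _} uniq _ p first  = Unique[x∷xs]⇒x∉xs uniq (Paired-∈ p)
Paired-offset-disjoint {xs = _ ∷ _ ∷ _} uniq _ p second = Unique[x∷xs]⇒x∉xs uniq (Paired-∈ (Paired-sym p))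
Paired-offset-disjoint (_ ∷ uniq) e∉ first (later q) =
  ∉-∷ʳ (Unique[x∷xs]⇒x∉xs uniq) (λ c≡e → e∉ (here (sym c≡e))) (Paired-∈ q)
Paired-offset-disjoint (_ ∷ uniq) e∉ second (later q) =
  ∉-∷ʳ (Unique[x∷xs]⇒x∉xs uniq) (λ c≡e → e∉ (here (sym c≡e))) (Paired-∈ (Paired-sym q))
Paired-offset-disjoint (_ ∷ _ ∷ uniq) e∉ (later p) (later q) =
  Paired-offset-disjoint uniq (e∉ ∘ there ∘ there) p q

Unique-rotate : Unique (x ∷ xs) → Unique (xs ∷ʳ x)
Unique-rotate {x = x} {xs} = Unique-resp-↭ (∷↭∷ʳ x xs)

-- On a two-element list both pairings are the same single pair, hence the length bound.
Paired-rotate-disjoint : Unique (x ∷ xs) → 3 ≤ length (x ∷ xs) →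
                         Paired (x ∷ xs) u w → Paired (xs ∷ʳ x) u w → ⊥
Paired-rotate-disjoint {xs = _ ∷ []} _ (s≤s (s≤s ()))
Paired-rotate-disjoint {xs = _ ∷ _ ∷ _} uniq _ first q =
  Unique[x∷xs]⇒x∉xs uniq (there (here (sym (Paired-functional (Unique-rotate uniq) first (Paired-sym q)))))
Paired-rotate-disjoint {xs = _ ∷ _ ∷ _} uniq _ second q =
  Unique[x∷xs]⇒x∉xs uniq (there (here (sym (Paired-functional (Unique-rotate uniq) first q))))
Paired-rotate-disjoint uniq@(_ ∷ uniq′) _ (later p) q =
  Paired-offset-disjoint uniq′ (Unique[x∷xs]⇒x∉xs uniq ∘ there) p q

module _ (G : Graph) where
  open Graph G using (n; Adj; irrefl) renaming (sym to Adj-sym)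
  open PerfectMatching

  partner : PerfectMatching G → Fin n → Fin n
  partner M u = proj₁ (cover M u)

  partner-Has : (M : PerfectMatching G) (u : Fin n) → Has M u (partner M u)
  partner-Has M u = proj₂ (cover M u)

  partner-involutive : (M : PerfectMatching G) (u : Fin n) → partner M (partner M u) ≡ u
  partner-involutive M u = unique M (partner-Has M (partner M u)) (has-sym M (partner-Has M u))

  partner-no-fixed-point : (M : PerfectMatching G) (u : Fin n) → partner M u ≢ u
  partner-no-fixed-point M u eq = irrefl (has-adj M (subst (Has M u) eq (partner-Has M u)))

  PerfectMatching⇒even-length : PerfectMatching G → {vs : List (Fin n)} →
                         Unique vs → (∀ u → u ∈ vs) → 2 ∣ length vs
  PerfectMatching⇒even-length M uniq spans =
    Involution.even-length (partner-involutive M) (partner-no-fixed-point M) uniq (λ _ → spans _)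

  pairingMatching : {vs : List (Fin n)} → Unique vs → (∀ u → u ∈ vs) → 2 ∣ length vs →
                    Linked Adj vs → PerfectMatching G
  pairingMatching {vs} uniq spans even path = record
    { edges  = record { Has = Paired vs ; has-sym = Paired-sym ; has-adj = Paired⇒related Adj-sym path }
    ; cover  = λ u → Paired-cover even (spans u)
    ; unique = Paired-functional uniq
    }

corollary2p3 : (G : Graph) → MatchingCovered G → Hamiltonian G → ThreePMAdmissible G
corollary2p3 G mc (v , [] , _ , _ , s≤s () , _)
corollary2p3 G mc@(_ , edge-in-pm) (v , vs@(_ ∷ _) , uniq , spans , 3≤ , cycle) =
  mc , M₀ , M₁ , M₀ , λ _ _ h₀ h₁ _ → Paired-rotate-disjoint uniq 3≤ h₀ h₁
  where
  even : 2 ∣ length (v ∷ vs)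
  even = PerfectMatching⇒even-length G (proj₁ (edge-in-pm _ _ (Linked.head cycle))) uniq spans

  rotation : v ∷ vs ↭ vs ∷ʳ v
  rotation = ∷↭∷ʳ v vs

  M₀ M₁ : PerfectMatching G
  M₀ = pairingMatching G uniq spans even (Linked-++⁻ˡ (v ∷ vs) cycle)
  M₁ = pairingMatching G (Unique-rotate uniq) (∈-resp-↭ rotation ∘ spans)
         (subst (2 ∣_) (↭-length rotation) even) (Linked.tail cycle)
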